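{- Let $G$ be a finite simple connected graph with threshold function $\theta:V(G)\to\mathbb{Z}$, and suppose $v$ is a cut-vertex of $G$ such that $G=G_1\oplus_v G_2$. Define $\theta_1$ on $G_1-v$ by $\theta_1(x)=\theta(x)-1$ for $x\in N_{G_1}(v)$ and $\theta_1(x)=\theta(x)$ otherwise. Let $S_1$ be an optimal target set for $(G_1-v,\theta_1)$ which, among all optimal target sets for $(G_1-v,\theta_1)$, maximizes $|N_{G_1}(v)\cap [S_1]^{G_1}_\theta|$ (with $\theta$ restricted to $V(G_1)$). Define $\theta_2$ on $G_2$ by $\theta_2(v)=\theta(v)-|N_{G_1}(v)\cap [S_1]^{G_1}_\theta|$ and $\theta_2(x)=\theta(x)$ for $x\in V(G_2)\setminus\{v\}$. Then $\text{min-seed}(G,\theta)=\text{min-seed}(G_1-v,\theta_1)+\text{min-seed}(G_2,\theta_2)$.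
   Context: A social network $(H,\theta)$ is a finite simple graph $H$ with a threshold function $\theta:V(H)\to\mathbb{Z}$. For a target set $S\subseteq V(H)$, the activation process is: at time $0$ the vertices of $S$ are active and all others inactive; at each subsequent time step, every inactive vertex $u$ having at least $\theta(u)$ active neighbours becomes active (so an inactive vertex with $\theta(u)\le 0$ becomes active at the next step). The process stops when no more vertices become active; $[S]^H_\theta$ denotes the set of active vertices at the end. $\text{min-seed}(H,\theta)=\min\{|S|: S\subseteq V(H),\ [S]^H_\theta=V(H)\}$, and an optimal target set for $(H,\theta)$ is a set $S$ with $[S]^H_\theta=V(H)$ and $|S|=\text{min-seed}(H,\theta)$. For a cut-vertex $v$ of $G$: if $G-v$ is the disjoint union of two graphs $W_1,W_2$ and $G_i$ is the subgraph of $G$ induced by $\{v\}\cup V(W_i)$ ($i=1,2$), then $G$ is called the vertex-sum of $G_1$ and $G_2$ at $v$, written $G=G_1\oplus_v G_2$. -}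

module Defs where

open import Data.Nat using (ℕ; zero; suc; _≤_)
open import Data.Integer using (ℤ; +_) renaming (_-_ to _-ℤ_) renaming (_≤?_ to _≤ℤ?_)
open import Data.Bool using (Bool; true; false; _∧_; if_then_else_)
open import Data.Fin using (Fin)
open import Data.Fin.Subset using (Subset; _∈_; _∉_; _⊆_; _∩_; _∪_; ∣_∣; ⊤; _-_; Nonempty)
open import Data.Vec using (lookup; tabulate)
open import Data.Product using (_×_; Σ; ∃)
open import Data.Sum using (_⊎_)
open import Data.Empty using (⊥)
open import Relation.Nullary using (¬_; does)
open import Relation.Binary.PropositionalEquality using (_≡_)

record Graph (n : ℕ) : Set where
  field
    adj   : Fin n → Fin n → Bool
    sym   : ∀ x y → adj x y ≡ adj y x
    irrefl : ∀ x → adj x x ≡ false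
open Graph public

nbr : ∀ {n} → Graph n → Fin n → Subset n
nbr G u = tabulate (adj G u)

-- All graphs considered (G, G₁, G₂, G₁ - v, G - v) are induced subgraphs
-- G[U] of the host graph G, given by their vertex set U : Subset n.
-- Neighbourhood of u in the induced subgraph G[U]:
nbrIn : ∀ {n} → Graph n → Subset n → Fin n → Subset n
nbrIn G U u = nbr G u ∩ U

step : ∀ {n} → Graph n → Subset n → (Fin n → ℤ) → Subset n → Subset n
step G U θ S =
  S ∪ (U ∩ tabulate (λ u → does (θ u ≤ℤ? (+ ∣ nbrIn G U u ∩ S ∣))))

iterate : ∀ {A : Set} → ℕ → (A → A) → A → A
iterate zero    f a = a
iterate (suc k) f a = iterate k f (f a)

-- [S]^{G[U]}_θ : the final active set. The process is monotone and adds
-- at least one vertex per non-final step, so it stabilises within n steps.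
closure : ∀ {n} → Graph n → Subset n → (Fin n → ℤ) → Subset n → Subset n
closure {n} G U θ S = iterate n (step G U θ) S

IsTargetSet : ∀ {n} → Graph n → Subset n → (Fin n → ℤ) → Subset n → Set
IsTargetSet G U θ S = S ⊆ U × closure G U θ S ≡ U

IsMinSeed : ∀ {n} → Graph n → Subset n → (Fin n → ℤ) → ℕ → Set
IsMinSeed G U θ k =
  (Σ (Subset _) λ S → IsTargetSet G U θ S × ∣ S ∣ ≡ k)
  × (∀ T → IsTargetSet G U θ T → k ≤ ∣ T ∣)

IsOptimal : ∀ {n} → Graph n → Subset n → (Fin n → ℤ) → Subset n → Set
IsOptimal G U θ S =
  IsTargetSet G U θ S × (∀ T → IsTargetSet G U θ T → ∣ S ∣ ≤ ∣ T ∣)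

data Reach {n} (G : Graph n) (U : Subset n) : Fin n → Fin n → Set where
  here : ∀ {x} → Reach G U x x
  there : ∀ {x y z} → adj G x y ≡ true → y ∈ U → Reach G U y z → Reach G U x z

Connected : ∀ {n} → Graph n → Subset n → Set
Connected G U = ∀ {x y} → x ∈ U → y ∈ U → Reach G U x y

IsCutVertex : ∀ {n} → Graph n → Fin n → Set
IsCutVertex G v = ¬ Connected G (⊤ - v)

IsVertexSumSplit : ∀ {n} → Graph n → Fin n → Subset n → Subset n → Set
IsVertexSumSplit G v A₁ A₂ =
  v ∉ A₁ × v ∉ A₂
  × (∀ x → ¬ (x ≡ v) → x ∈ A₁ ⊎ x ∈ A₂)
  × (∀ x → ¬ (x ∈ A₁ × x ∈ A₂))
  × (∀ x y → x ∈ A₁ → y ∈ A₂ → adj G x y ≡ false)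
  × Nonempty A₁ × Nonempty A₂

-- θ₁(x) = θ(x) - 1 if x ∈ N(v) (with N computed in G₁; on G₁ - v this is
-- the same as N_G(v)), θ(x) otherwise.
theta1 : ∀ {n} → Graph n → Subset n → Fin n → (Fin n → ℤ) → Fin n → ℤ
theta1 G U₁ v θ x = if lookup (nbrIn G U₁ v) x then θ x -ℤ + 1 else θ x

theta2 : ∀ {n} → Fin n → (Fin n → ℤ) → ℕ → Fin n → ℤ
theta2 v θ m x = if does (x Data.Fin.≟ v) then θ x -ℤ + m else θ x

module Submission where

-- Write A₁, A₂ for the two sides of G - v, U₁ = {v} ∪ A₁ and U₂ = {v} ∪ A₂.
-- The argument rests on the order-theoretic reading of the activation process:
-- [S]^{G[U]}_θ is the least θ-closed subset of U containing S, where D is closed when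
-- every vertex u ∈ U with at least θ(u) neighbours in D ∩ U already lies in D.
-- Closedness is checked vertex by vertex, and a vertex of A₁ (resp. A₂) only sees U₁
-- (resp. U₂); so closed sets of G can be assembled from closed sets of the pieces and
-- conversely restricted to them.
--  * Upper bound: if S₁, S₂ are target sets of (G₁ - v, θ₁) and (G₂, θ₂), the closure
--    C of S₁ ∪ S₂ in G contains [S₁]^{G₁}_θ, so v has m(S₁) active neighbours in A₁;
--    hence C is closed in (G₂, θ₂) and contains U₂, and then, v being active, C is
--    closed in (G₁ - v, θ₁) and contains A₁.
--  * Lower bound: for a target set T of G, T₁ = T ∩ A₁ is a target set of
--    (G₁ - v, θ₁) and T₂ = T ∩ U₂ becomes one of (G₂, θ₂) after adding v.  If T₁ is
--    itself optimal, maximality of S₁ gives m(T₁) ≤ m(S₁), and then T₂ alone already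
--    activates v in (G₂, θ₂).

open import Defs renaming (sym to adj-sym)
open import Data.Nat using (ℕ; _≤_; _+_; suc; zero; z≤n; s≤s)
import Data.Nat.Properties as NP
open import Data.Integer using (ℤ; +_)
import Data.Integer as Z
import Data.Integer.Properties as ZP
open import Data.Bool using (Bool; true; false)
open import Data.Fin using (Fin; zero; suc; _≟_)
open import Data.Fin.Subset
  using (Subset; _∪_; _∩_; _-_; ⁅_⁆; ⊤; ∣_∣; _∈_; _∉_; _⊆_; inside; outside)
open import Data.Fin.Subset.Properties
open import Data.Vec using ([]; _∷_; there; lookup; tabulate)
open import Data.Vec.Properties using (lookup∘tabulate; []=⇒lookup; lookup⇒[]=)
open import Data.Product using (_×_; _,_; proj₁; proj₂; Σ)
open import Data.Sum using (_⊎_; inj₁; inj₂; [_,_]′; map₁)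
open import Data.Empty using (⊥; ⊥-elim)
open import Function using (id)
open import Relation.Nullary using (¬_; Dec; yes; no; does; contradiction)
open import Relation.Nullary.Decidable using (dec-true)
open import Relation.Binary.PropositionalEquality
  using (_≡_; _≢_; refl; sym; trans; cong; cong₂; subst)

∈-tabulate⁻ : ∀ {n} {f : Fin n → Bool} {x} → x ∈ tabulate f → f x ≡ true
∈-tabulate⁻ {f = f} {x} h = trans (sym (lookup∘tabulate f x)) ([]=⇒lookup h)

∈-tabulate⁺ : ∀ {n} {f : Fin n → Bool} {x} → f x ≡ true → x ∈ tabulate f
∈-tabulate⁺ {f = f} {x} h = lookup⇒[]= x (tabulate f) (trans (lookup∘tabulate f x) h)

does-true : ∀ {P : Set} (d : Dec P) → does d ≡ true → P
does-true (yes p) _ = p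

∪-left : ∀ {n} {p q : Subset n} {x} → x ∈ p ∪ q → x ∉ q → x ∈ p
∪-left {p = p} {q} h x∉q = [ id , (λ x∈q → contradiction x∈q x∉q) ]′ (x∈p∪q⁻ p q h)

∪-right : ∀ {n} {p q : Subset n} {x} → x ∈ p ∪ q → x ∉ p → x ∈ q
∪-right {p = p} {q} h x∉p = [ (λ x∈p → contradiction x∈p x∉p) , id ]′ (x∈p∪q⁻ p q h)

x∉p-x : ∀ {n} {p : Subset n} (x : Fin n) → x ∉ p - x
x∉p-x {p = _ ∷ _} zero    ()
x∉p-x {p = _ ∷ p} (suc x) (there h) = x∉p-x {p = p} x h

Disjoint : ∀ {n} → Subset n → Subset n → Set
Disjoint p q = ∀ {x} → x ∈ p → x ∈ q → ⊥

∣p∪q∣+∣p∩q∣ : ∀ {n} (p q : Subset n) → ∣ p ∪ q ∣ + ∣ p ∩ q ∣ ≡ ∣ p ∣ + ∣ q ∣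
∣p∪q∣+∣p∩q∣ [] [] = refl
∣p∪q∣+∣p∩q∣ (inside ∷ p) (inside ∷ q) =
  cong suc (trans (NP.+-suc _ _) (trans (cong suc (∣p∪q∣+∣p∩q∣ p q)) (sym (NP.+-suc _ _))))
∣p∪q∣+∣p∩q∣ (inside ∷ p) (outside ∷ q) = cong suc (∣p∪q∣+∣p∩q∣ p q)
∣p∪q∣+∣p∩q∣ (outside ∷ p) (inside ∷ q) = trans (cong suc (∣p∪q∣+∣p∩q∣ p q)) (sym (NP.+-suc _ _))
∣p∪q∣+∣p∩q∣ (outside ∷ p) (outside ∷ q) = ∣p∪q∣+∣p∩q∣ p q

∣p∪q∣≤∣p∣+∣q∣ : ∀ {n} (p q : Subset n) → ∣ p ∪ q ∣ ≤ ∣ p ∣ + ∣ q ∣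
∣p∪q∣≤∣p∣+∣q∣ p q = subst (∣ p ∪ q ∣ ≤_) (∣p∪q∣+∣p∩q∣ p q) (NP.m≤m+n _ _)

∣p∪q∣≡∣p∣+∣q∣ : ∀ {n} {p q : Subset n} → Disjoint p q → ∣ p ∪ q ∣ ≡ ∣ p ∣ + ∣ q ∣
∣p∪q∣≡∣p∣+∣q∣ {n} {p} {q} disj = begin
  ∣ p ∪ q ∣             ≡⟨ sym (NP.+-identityʳ _) ⟩
  ∣ p ∪ q ∣ + 0         ≡⟨ cong (_+_ ∣ p ∪ q ∣) (sym ∣p∩q∣≡0) ⟩
  ∣ p ∪ q ∣ + ∣ p ∩ q ∣ ≡⟨ ∣p∪q∣+∣p∩q∣ p q ⟩
  ∣ p ∣ + ∣ q ∣         ∎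
  where
  open Relation.Binary.PropositionalEquality.≡-Reasoning
  ∣p∩q∣≡0 : ∣ p ∩ q ∣ ≡ 0
  ∣p∩q∣≡0 = trans (cong ∣_∣ (Empty-unique λ { (x , h) →
    let (x∈p , x∈q) = x∈p∩q⁻ p q h in disj x∈p x∈q })) (∣⊥∣≡0 n)

disjoint-parts : ∀ {n} {p q r : Subset n} → p ⊆ r → q ⊆ r → Disjoint p q → ∣ p ∣ + ∣ q ∣ ≤ ∣ r ∣
disjoint-parts {p = p} {q} p⊆r q⊆r disj =
  subst (_≤ _) (∣p∪q∣≡∣p∣+∣q∣ disj) (p⊆q⇒∣p∣≤∣q∣ λ h → [ p⊆r , q⊆r ]′ (x∈p∪q⁻ p q h))

deg : ∀ {n} → Graph n → Subset n → Fin n → Subset n → ℕ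
deg G U u D = ∣ nbrIn G U u ∩ D ∣

Counted : ∀ {n} → Graph n → Subset n → Fin n → Subset n → Fin n → Set
Counted G U u D w = adj G u w ≡ true × w ∈ U × w ∈ D

module Degrees {n} (G : Graph n) {u : Fin n} where

  counted⁻ : ∀ {U D w} → w ∈ nbrIn G U u ∩ D → Counted G U u D w
  counted⁻ {U} {D} h =
    let (w∈N , w∈D) = x∈p∩q⁻ _ D h
        (w∈nbr , w∈U) = x∈p∩q⁻ _ U w∈N
    in ∈-tabulate⁻ w∈nbr , w∈U , w∈D

  counted⁺ : ∀ {U D w} → Counted G U u D w → w ∈ nbrIn G U u ∩ D
  counted⁺ (a , w∈U , w∈D) = x∈p∩q⁺ (x∈p∩q⁺ (∈-tabulate⁺ a , w∈U) , w∈D)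

  deg-mono : ∀ {U U′ D D′} → (∀ {w} → Counted G U u D w → Counted G U′ u D′ w) →
             deg G U u D ≤ deg G U′ u D′
  deg-mono f = p⊆q⇒∣p∣≤∣q∣ λ h → counted⁺ (f (counted⁻ h))

  deg-monoʳ : ∀ {U D D′} → D ⊆ D′ → deg G U u D ≤ deg G U u D′
  deg-monoʳ D⊆D′ = deg-mono λ (a , w∈U , w∈D) → a , w∈U , D⊆D′ w∈D

  deg-monoˡ : ∀ {U U′ D} → U ⊆ U′ → deg G U u D ≤ deg G U′ u D
  deg-monoˡ U⊆U′ = deg-mono λ (a , w∈U , w∈D) → a , U⊆U′ w∈U , w∈D

  deg-split : ∀ {U D U₁ D₁ U₂ D₂} →
              (∀ {w} → Counted G U u D w → Counted G U₁ u D₁ w ⊎ Counted G U₂ u D₂ w) →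
              deg G U u D ≤ deg G U₁ u D₁ + deg G U₂ u D₂
  deg-split {U₁ = U₁} {D₁} {U₂} {D₂} f = NP.≤-trans
    (p⊆q⇒∣p∣≤∣q∣ λ h → x∈p∪q⁺ ([ (λ c → inj₁ (counted⁺ c)) , (λ c → inj₂ (counted⁺ c)) ]′ (f (counted⁻ h))))
    (∣p∪q∣≤∣p∣+∣q∣ (nbrIn G U₁ u ∩ D₁) (nbrIn G U₂ u ∩ D₂))

  counted-in-⊤ : ∀ {U D w} → Counted G U u D w → Counted G ⊤ u D w
  counted-in-⊤ (a , _ , w∈D) = a , ∈⊤ , w∈D

  deg-merge : ∀ {U D U₁ D₁ U₂ D₂} →
              (∀ {w} → Counted G U₁ u D₁ w → Counted G U u D w) →
              (∀ {w} → Counted G U₂ u D₂ w → Counted G U u D w) →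
              (∀ {w} → Counted G U₁ u D₁ w → Counted G U₂ u D₂ w → ⊥) →
              deg G U₁ u D₁ + deg G U₂ u D₂ ≤ deg G U u D
  deg-merge f₁ f₂ disj = disjoint-parts
    (λ h → counted⁺ (f₁ (counted⁻ h))) (λ h → counted⁺ (f₂ (counted⁻ h)))
    (λ h₁ h₂ → disj (counted⁻ h₁) (counted⁻ h₂))

  deg-⁅⁆-adjacent : ∀ {v} → adj G u v ≡ true → deg G ⁅ v ⁆ u ⊤ ≡ 1
  deg-⁅⁆-adjacent {v} a = trans (cong ∣_∣ (⊆-antisym only-v v-counted)) (∣⁅x⁆∣≡1 v)
    where
    only-v : nbrIn G ⁅ v ⁆ u ∩ ⊤ ⊆ ⁅ v ⁆
    only-v h = proj₁ (proj₂ (counted⁻ h))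
    v-counted : ⁅ v ⁆ ⊆ nbrIn G ⁅ v ⁆ u ∩ ⊤
    v-counted h with x∈⁅y⁆⇒x≡y v h
    ... | refl = counted⁺ (a , x∈⁅x⁆ v , ∈⊤)

  deg-⁅⁆-nonadjacent : ∀ {v} → adj G u v ≡ false → deg G ⁅ v ⁆ u ⊤ ≡ 0
  deg-⁅⁆-nonadjacent {v} na = trans (cong ∣_∣ (Empty-unique no-member)) (∣⊥∣≡0 n)
    where
    no-member : ¬ Σ (Fin n) (λ w → w ∈ nbrIn G ⁅ v ⁆ u ∩ ⊤)
    no-member (w , h) with counted⁻ h
    ... | a , w∈⁅v⁆ , _ with x∈⁅y⁆⇒x≡y v w∈⁅v⁆
    ... | refl = contradiction (trans (sym a) na) λ ()

-- Lowering a threshold by δ is the same as granting δ extra active neighbours.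
module _ where
  open ZP.≤-Reasoning

  [a+δ]-δ≡a : ∀ a δ → + (a + δ) Z.- + δ ≡ + a
  [a+δ]-δ≡a a δ = begin-equality
    + (a + δ) Z.- + δ        ≡⟨ cong (Z._- + δ) (ZP.pos-+ a δ) ⟩
    + a Z.+ + δ Z.- + δ      ≡⟨ ZP.+-assoc (+ a) (+ δ) (Z.- + δ) ⟩
    + a Z.+ (+ δ Z.- + δ)    ≡⟨ cong (Z._+_ (+ a)) (ZP.+-inverseʳ (+ δ)) ⟩
    + a Z.+ + 0              ≡⟨ ZP.+-identityʳ (+ a) ⟩
    + a                      ∎

  t-δ+δ≡t : ∀ (t : ℤ) δ → t Z.- + δ Z.+ + δ ≡ t
  t-δ+δ≡t t δ = begin-equality
    t Z.- + δ Z.+ + δ        ≡⟨ ZP.+-assoc t (Z.- + δ) (+ δ) ⟩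
    t Z.+ (Z.- + δ Z.+ + δ)  ≡⟨ cong (Z._+_ t) (ZP.+-inverseˡ (+ δ)) ⟩
    t Z.+ + 0                ≡⟨ ZP.+-identityʳ t ⟩
    t                        ∎

  lowered-threshold-met : ∀ {t t′ : ℤ} {a b} δ → t′ ≡ t Z.- + δ →
                          t Z.≤ + b → b ≤ a + δ → t′ Z.≤ + a
  lowered-threshold-met {t} {a = a} {b} δ refl t≤b b≤a+δ = begin
    t Z.- + δ                ≤⟨ ZP.+-monoˡ-≤ (Z.- + δ) (ZP.≤-trans t≤b (Z.+≤+ b≤a+δ)) ⟩
    + (a + δ) Z.- + δ        ≡⟨ [a+δ]-δ≡a a δ ⟩
    + a                      ∎

  raised-threshold-met : ∀ {t t′ : ℤ} {a b} δ → t′ ≡ t Z.- + δ →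
                         t′ Z.≤ + a → a + δ ≤ b → t Z.≤ + b
  raised-threshold-met {t} {a = a} {b} δ refl t′≤a a+δ≤b = begin
    t                        ≡⟨ sym (t-δ+δ≡t t δ) ⟩
    t Z.- + δ Z.+ + δ        ≤⟨ ZP.+-monoˡ-≤ (+ δ) t′≤a ⟩
    + a Z.+ + δ              ≡⟨ sym (ZP.pos-+ a δ) ⟩
    + (a + δ)                ≤⟨ Z.+≤+ a+δ≤b ⟩
    + b                      ∎

Closed : ∀ {n} → Graph n → Subset n → (Fin n → ℤ) → Subset n → Set
Closed G U θ D = ∀ {u} → u ∈ U → θ u Z.≤ + deg G U u D → u ∈ D

closed-restrict : ∀ {n} (G : Graph n) {U U′ θ D} → U ⊆ U′ → Closed G U′ θ D → Closed G U θ D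
closed-restrict G U⊆U′ D-closed u∈U met =
  D-closed (U⊆U′ u∈U) (ZP.≤-trans met (Z.+≤+ (Degrees.deg-monoˡ G U⊆U′)))

iterate-preserves : ∀ {A : Set} (P : A → Set) {f : A → A} →
                    (∀ {a} → P a → P (f a)) → ∀ k {a} → P a → P (iterate k f a)
iterate-preserves P pres zero    pa = pa
iterate-preserves P pres (suc k) pa = iterate-preserves P pres k (pres pa)

iterate-suc : ∀ {A : Set} (f : A → A) k a → iterate (suc k) f a ≡ f (iterate k f a)
iterate-suc f zero    a = refl
iterate-suc f (suc k) a = iterate-suc f k (f a)

-- The activation closure [S] is the least closed set containing S.
module Activation {n} (G : Graph n) (U : Subset n) (θ : Fin n → ℤ) where
  open Degrees G

  activated : Subset n → Subset n
  activated X = U ∩ tabulate (λ u → does (θ u Z.≤? + deg G U u X))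

  activated⁻ : ∀ {X u} → u ∈ activated X → u ∈ U × θ u Z.≤ + deg G U u X
  activated⁻ {X} h =
    let (u∈U , met) = x∈p∩q⁻ U _ h
    in u∈U , does-true (θ _ Z.≤? _) (∈-tabulate⁻ met)

  activated⁺ : ∀ {X u} → u ∈ U → θ u Z.≤ + deg G U u X → u ∈ activated X
  activated⁺ {X} {u} u∈U met = x∈p∩q⁺ (u∈U , ∈-tabulate⁺ (dec-true (θ u Z.≤? _) met))

  step-inflationary : ∀ X → X ⊆ step G U θ X
  step-inflationary X = p⊆p∪q (activated X)

  step-mono : ∀ {X Y} → X ⊆ Y → step G U θ X ⊆ step G U θ Y
  step-mono {X} X⊆Y h with x∈p∪q⁻ X (activated X) h
  ... | inj₁ x∈X = x∈p∪q⁺ (inj₁ (X⊆Y x∈X))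
  ... | inj₂ x∈a = let (u∈U , met) = activated⁻ x∈a in
    x∈p∪q⁺ (inj₂ (activated⁺ u∈U (ZP.≤-trans met (Z.+≤+ (deg-monoʳ X⊆Y)))))

  step-least : ∀ {X C} → X ⊆ C → Closed G U θ C → step G U θ X ⊆ C
  step-least {X} X⊆C C-closed h with x∈p∪q⁻ X (activated X) h
  ... | inj₁ x∈X = X⊆C x∈X
  ... | inj₂ x∈a = let (u∈U , met) = activated⁻ x∈a in
    C-closed u∈U (ZP.≤-trans met (Z.+≤+ (deg-monoʳ X⊆C)))

  fixed-point-closed : ∀ {X} → step G U θ X ⊆ X → Closed G U θ X
  fixed-point-closed {X} fixed u∈U met = fixed (q⊆p∪q X _ (activated⁺ u∈U met))

  closure-ext : ∀ S → S ⊆ closure G U θ S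
  closure-ext S = iterate-preserves (λ X → S ⊆ X)
    (λ {X} S⊆X x∈S → step-inflationary X (S⊆X x∈S)) n id

  closure-least : ∀ {S C} → S ⊆ C → Closed G U θ C → closure G U θ S ⊆ C
  closure-least S⊆C C-closed =
    iterate-preserves (λ X → X ⊆ _) (λ X⊆C → step-least X⊆C C-closed) n S⊆C

  closure-within : ∀ {S} → S ⊆ U → closure G U θ S ⊆ U
  closure-within S⊆U = closure-least S⊆U (λ u∈U _ → u∈U)

  stopped-or-large : ∀ S k → let X = iterate k (step G U θ) S in
                     step G U θ X ⊆ X ⊎ k ≤ ∣ X ∣
  stopped-or-large S zero = inj₂ z≤n
  stopped-or-large S (suc k) rewrite iterate-suc (step G U θ) k S
    with stopped-or-large S k
  ... | inj₁ stopped = inj₁ (step-mono stopped)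
  ... | inj₂ large with iterate k (step G U θ) S ⊂? step G U θ (iterate k (step G U θ) S)
  ...   | yes grows = inj₂ (NP.≤-trans (s≤s large) (p⊂q⇒∣p∣<∣q∣ grows))
  ...   | no ¬grows = inj₁ (step-mono stops)
    where
    X = iterate k (step G U θ) S
    stops : step G U θ X ⊆ X
    stops {x} x∈step with x ∈? X
    ... | yes x∈X = x∈X
    ... | no x∉X = ⊥-elim (¬grows (step-inflationary X , x , x∈step , x∉X))

  closure-closed : ∀ S → Closed G U θ (closure G U θ S)
  closure-closed S with stopped-or-large S n
  ... | inj₁ stopped = fixed-point-closed stopped
  ... | inj₂ large = fixed-point-closed λ {x} _ →
    subst (x ∈_) (sym (∣p∣≡n⇒p≡⊤ (NP.≤-antisym (∣p∣≤n (closure G U θ S)) large))) ∈⊤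

  -- Every activated non-seed vertex meets its threshold against the final active set:
  -- W ∩ [S] with W = activated [S] ∪ S is closed and contains S, hence contains [S].
  closure-supported : ∀ S {u} → u ∈ closure G U θ S → u ∉ S →
                      θ u Z.≤ + deg G U u (closure G U θ S)
  closure-supported S {u} u∈Cl u∉S = proj₂ (activated⁻ (∪-left u∈W u∉S))
    where
    Cl = closure G U θ S
    W = activated Cl ∪ S
    W∩Cl-closed : Closed G U θ (W ∩ Cl)
    W∩Cl-closed u∈U met =
      let met′ = ZP.≤-trans met (Z.+≤+ (deg-monoʳ (p∩q⊆q W Cl))) in
      x∈p∩q⁺ (p⊆p∪q S (activated⁺ u∈U met′) , closure-closed S u∈U met′)
    u∈W : u ∈ W
    u∈W = p∩q⊆p W Cl (closure-least (λ h → x∈p∩q⁺ (q⊆p∪q _ S h , closure-ext S h)) W∩Cl-closed u∈Cl)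

  target-fills : ∀ {T D} → IsTargetSet G U θ T → T ⊆ D → Closed G U θ D → U ⊆ D
  target-fills (_ , [T]≡U) T⊆D D-closed u∈U =
    closure-least T⊆D D-closed (subst (_ ∈_) (sym [T]≡U) u∈U)

  target-intro : ∀ {S} → S ⊆ U → U ⊆ closure G U θ S → IsTargetSet G U θ S
  target-intro S⊆U U⊆[S] = S⊆U , ⊆-antisym (closure-within S⊆U) U⊆[S]

open Activation

optimal-size : ∀ {n} (G : Graph n) U θ {k S} → IsMinSeed G U θ k → IsOptimal G U θ S → ∣ S ∣ ≡ k
optimal-size G U θ ((S₀ , S₀-target , refl) , minimal) (S-target , S-least) =
  NP.≤-antisym (S-least S₀ S₀-target) (minimal _ S-target)

min-size-optimal : ∀ {n} (G : Graph n) U θ {k T} → IsMinSeed G U θ k → IsTargetSet G U θ T →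
                   ∣ T ∣ ≡ k → IsOptimal G U θ T
min-size-optimal G U θ (_ , minimal) T-target refl = T-target , minimal

module VertexSum {n} (G : Graph n) (θ : Fin n → ℤ) (v : Fin n) (A₁ A₂ : Subset n)
                 (split : IsVertexSumSplit G v A₁ A₂) where

  open Degrees G

  U₁ U₂ : Subset n
  U₁ = ⁅ v ⁆ ∪ A₁
  U₂ = ⁅ v ⁆ ∪ A₂

  θ₁ : Fin n → ℤ
  θ₁ = theta1 G U₁ v θ

  θ₂ : ℕ → Fin n → ℤ
  θ₂ = theta2 v θ

  m : Subset n → ℕ
  m S = deg G U₁ v (closure G U₁ θ S)

  v∉A₁ : v ∉ A₁
  v∉A₁ = proj₁ split

  v∉A₂ : v ∉ A₂
  v∉A₂ = proj₁ (proj₂ split)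

  covers : ∀ x → x ≢ v → x ∈ A₁ ⊎ x ∈ A₂
  covers = proj₁ (proj₂ (proj₂ split))

  sides-disjoint : ∀ x → ¬ (x ∈ A₁ × x ∈ A₂)
  sides-disjoint = proj₁ (proj₂ (proj₂ (proj₂ split)))

  no-edge : ∀ x y → x ∈ A₁ → y ∈ A₂ → adj G x y ≡ false
  no-edge = proj₁ (proj₂ (proj₂ (proj₂ (proj₂ split))))

  data Position (x : Fin n) : Set where
    is-v  : x ≡ v → Position x
    in-A₁ : x ∈ A₁ → Position x
    in-A₂ : x ∈ A₂ → Position x

  position : ∀ x → Position x
  position x with x ≟ v
  ... | yes x≡v = is-v x≡v
  ... | no  x≢v = [ in-A₁ , in-A₂ ]′ (covers x x≢v)

  v∈U₁ : v ∈ U₁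
  v∈U₁ = p⊆p∪q A₁ (x∈⁅x⁆ v)

  v∈U₂ : v ∈ U₂
  v∈U₂ = p⊆p∪q A₂ (x∈⁅x⁆ v)

  A₁⊆U₁ : A₁ ⊆ U₁
  A₁⊆U₁ = q⊆p∪q ⁅ v ⁆ A₁

  A₂⊆U₂ : A₂ ⊆ U₂
  A₂⊆U₂ = q⊆p∪q ⁅ v ⁆ A₂

  U₁-cases : ∀ {x} → x ∈ U₁ → x ≡ v ⊎ x ∈ A₁
  U₁-cases h = map₁ (x∈⁅y⁆⇒x≡y v) (x∈p∪q⁻ ⁅ v ⁆ A₁ h)

  U₂-cases : ∀ {x} → x ∈ U₂ → x ≡ v ⊎ x ∈ A₂
  U₂-cases h = map₁ (x∈⁅y⁆⇒x≡y v) (x∈p∪q⁻ ⁅ v ⁆ A₂ h)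

  U₁∩U₂ : ∀ {x} → x ∈ U₁ → x ∈ U₂ → x ≡ v
  U₁∩U₂ x∈U₁ x∈U₂ with U₁-cases x∈U₁ | U₂-cases x∈U₂
  ... | inj₁ x≡v | _        = x≡v
  ... | inj₂ _   | inj₁ x≡v = x≡v
  ... | inj₂ x∈A₁ | inj₂ x∈A₂ = ⊥-elim (sides-disjoint _ (x∈A₁ , x∈A₂))

  A₂-off-v : ∀ {x} → x ∈ A₂ → x ≢ v
  A₂-off-v x∈A₂ refl = v∉A₂ x∈A₂

  A₁∉U₂ : ∀ {x} → x ∈ A₁ → x ∉ U₂
  A₁∉U₂ x∈A₁ x∈U₂ with U₁∩U₂ (A₁⊆U₁ x∈A₁) x∈U₂
  ... | refl = v∉A₁ x∈A₁

  U₁-v≡A₁ : U₁ - v ≡ A₁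
  U₁-v≡A₁ = ⊆-antisym ⊆A₁ (λ x∈A₁ → x∈p∧x≢y⇒x∈p-y (A₁⊆U₁ x∈A₁) λ { refl → v∉A₁ x∈A₁ })
    where
    ⊆A₁ : U₁ - v ⊆ A₁
    ⊆A₁ h with U₁-cases (p─q⊆p U₁ ⁅ v ⁆ h)
    ... | inj₁ refl = ⊥-elim (x∉p-x {p = U₁} v h)
    ... | inj₂ x∈A₁ = x∈A₁

  nbr-of-A₁ : ∀ {x w} → x ∈ A₁ → adj G x w ≡ true → w ∈ U₁
  nbr-of-A₁ {x} {w} x∈A₁ a with position w
  ... | is-v refl  = v∈U₁
  ... | in-A₁ w∈A₁ = A₁⊆U₁ w∈A₁
  ... | in-A₂ w∈A₂ = contradiction (trans (sym a) (no-edge x w x∈A₁ w∈A₂)) λ ()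

  nbr-of-A₂ : ∀ {x w} → x ∈ A₂ → adj G x w ≡ true → w ∈ U₂
  nbr-of-A₂ {x} {w} x∈A₂ a with position w
  ... | is-v refl  = v∈U₂
  ... | in-A₂ w∈A₂ = A₂⊆U₂ w∈A₂
  ... | in-A₁ w∈A₁ = contradiction (trans (sym a) (trans (adj-sym G x w) (no-edge w x w∈A₁ x∈A₂))) λ ()

  θ₁-shift : ∀ {x} → x ∈ A₁ → θ₁ x ≡ θ x Z.- + deg G ⁅ v ⁆ x ⊤
  θ₁-shift {x} x∈A₁ with lookup (nbrIn G U₁ v) x in e
  ... | true  = cong (λ d → θ x Z.- + d) (sym (deg-⁅⁆-adjacent adjacent))
    where
    adjacent : adj G x v ≡ true
    adjacent = trans (adj-sym G x v)
      (∈-tabulate⁻ (proj₁ (x∈p∩q⁻ _ U₁ (lookup⇒[]= x (nbrIn G U₁ v) e))))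
  ... | false = trans (sym (ZP.+-identityʳ (θ x)))
                      (cong (λ d → θ x Z.- + d) (sym (deg-⁅⁆-nonadjacent nonadjacent)))
    where
    nonadjacent : adj G x v ≡ false
    nonadjacent with adj G x v in a
    ... | false = refl
    ... | true  = contradiction (trans (sym ([]=⇒lookup x∈N)) e) λ ()
      where
      x∈N : x ∈ nbrIn G U₁ v
      x∈N = x∈p∩q⁺ (∈-tabulate⁺ (trans (adj-sym G v x) a) , A₁⊆U₁ x∈A₁)

  θ₂-at-v : ∀ μ → θ₂ μ v ≡ θ v Z.- + μ
  θ₂-at-v μ with v ≟ v
  ... | yes _  = refl
  ... | no v≢v = contradiction refl v≢v

  θ₂-off-v : ∀ μ {x} → x ≢ v → θ₂ μ x ≡ θ x
  θ₂-off-v μ {x} x≢v with x ≟ v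
  ... | yes x≡v = contradiction x≡v x≢v
  ... | no _    = refl

  v-nbrs-disjoint : ∀ {D D′ w} → Counted G U₂ v D w → Counted G U₁ v D′ w → ⊥
  v-nbrs-disjoint (a , w∈U₂ , _) (_ , w∈U₁ , _) with U₁∩U₂ w∈U₁ w∈U₂
  ... | refl = contradiction (trans (sym a) (irrefl G v)) λ ()

  A₁∌v : ∀ {w} → w ∈ A₁ → w ∈ ⁅ v ⁆ → ⊥
  A₁∌v w∈A₁ w∈⁅v⁆ with x∈⁅y⁆⇒x≡y v w∈⁅v⁆
  ... | refl = v∉A₁ w∈A₁

  -- A vertex of A₁ sees only U₁: if it meets θ in G against D and D ∩ U₁ lies in a
  -- set F closed in (G₁, θ), it lies in F.
  A₁-closed : ∀ {D F u} → (∀ {w} → w ∈ U₁ → w ∈ D → w ∈ F) → Closed G U₁ θ F →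
              u ∈ A₁ → θ u Z.≤ + deg G ⊤ u D → u ∈ F
  A₁-closed D∩U₁⊆F F-closed u∈A₁ met = F-closed (A₁⊆U₁ u∈A₁) (ZP.≤-trans met (Z.+≤+ (deg-mono
    λ (a , _ , w∈D) → let w∈U₁ = nbr-of-A₁ u∈A₁ a in a , w∈U₁ , D∩U₁⊆F w∈U₁ w∈D)))

  A₂-closed : ∀ {μ D E u} → (∀ {w} → w ∈ U₂ → w ∈ D → w ∈ E) → Closed G U₂ (θ₂ μ) E →
              u ∈ A₂ → θ u Z.≤ + deg G ⊤ u D → u ∈ E
  A₂-closed {μ} D∩U₂⊆E E-closed u∈A₂ met = E-closed (A₂⊆U₂ u∈A₂)
    (subst (Z._≤ _) (sym (θ₂-off-v μ (A₂-off-v u∈A₂))) (ZP.≤-trans met (Z.+≤+ (deg-mono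
      λ (a , _ , w∈D) → let w∈U₂ = nbr-of-A₂ u∈A₂ a in a , w∈U₂ , D∩U₂⊆E w∈U₂ w∈D))))

  -- If v has at least μ neighbours in C ∩ U₁, a closed set C of (G, θ) is closed in
  -- (G₂, θ₂ μ): those neighbours make up for the lowered threshold of v.
  restrict-to-G₂ : ∀ {C μ} → Closed G ⊤ θ C → μ ≤ deg G U₁ v C → Closed G U₂ (θ₂ μ) C
  restrict-to-G₂ {C} {μ} C-closed μ≤deg {u} u∈U₂ met with U₂-cases u∈U₂
  ... | inj₁ refl = C-closed ∈⊤ (raised-threshold-met μ (θ₂-at-v μ) met
        (NP.≤-trans (NP.+-monoʳ-≤ _ μ≤deg) (deg-merge counted-in-⊤ counted-in-⊤ v-nbrs-disjoint)))
  ... | inj₂ u∈A₂ = C-closed ∈⊤ (ZP.≤-trans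
        (subst (Z._≤ _) (θ₂-off-v μ (A₂-off-v u∈A₂)) met) (Z.+≤+ (deg-monoˡ ⊆⊤)))

  -- If v ∈ C, a closed set C of (G, θ) is closed in (G₁ - v, θ₁): the active vertex v
  -- makes up for the lowered thresholds of its neighbours.
  restrict-to-G₁-v : ∀ {C} → Closed G ⊤ θ C → v ∈ C → Closed G A₁ θ₁ C
  restrict-to-G₁-v {C} C-closed v∈C {u} u∈A₁ met =
    C-closed ∈⊤ (raised-threshold-met _ (θ₁-shift u∈A₁) met
      (deg-merge counted-in-⊤ v-active (λ (_ , w∈A₁ , _) (_ , w∈⁅v⁆ , _) → A₁∌v w∈A₁ w∈⁅v⁆)))
    where
    v-active : ∀ {w} → Counted G ⁅ v ⁆ u ⊤ w → Counted G ⊤ u C w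
    v-active (a , w∈⁅v⁆ , _) with x∈⁅y⁆⇒x≡y v w∈⁅v⁆
    ... | refl = a , ∈⊤ , v∈C

  -- A closed set D of (G₁ - v, θ₁) together with all of U₂ is closed in (G, θ): with
  -- v active, the thresholds θ₁ on A₁ are exactly the thresholds θ in G.
  extend-from-G₁-v : ∀ {D} → Closed G A₁ θ₁ D → Closed G ⊤ θ (D ∪ U₂)
  extend-from-G₁-v {D} D-closed {u} _ met with position u
  ... | is-v refl  = q⊆p∪q D U₂ v∈U₂
  ... | in-A₂ u∈A₂ = q⊆p∪q D U₂ (A₂⊆U₂ u∈A₂)
  ... | in-A₁ u∈A₁ = p⊆p∪q U₂ (D-closed u∈A₁
        (lowered-threshold-met _ (θ₁-shift u∈A₁) met (deg-split sides)))
    where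
    sides : ∀ {w} → Counted G ⊤ u (D ∪ U₂) w → Counted G A₁ u D w ⊎ Counted G ⁅ v ⁆ u ⊤ w
    sides (a , _ , w∈D∪U₂) with U₁-cases (nbr-of-A₁ u∈A₁ a)
    ... | inj₁ refl = inj₂ (a , x∈⁅x⁆ v , ∈⊤)
    ... | inj₂ w∈A₁ = inj₁ (a , w∈A₁ , ∪-left w∈D∪U₂ (A₁∉U₂ w∈A₁))

  extend-from-G₂ : ∀ {E μ} → v ∈ E → Closed G U₂ (θ₂ μ) E → Closed G ⊤ θ (E ∪ A₁)
  extend-from-G₂ {E} v∈E E-closed {u} _ met with position u
  ... | is-v refl  = p⊆p∪q A₁ v∈E
  ... | in-A₁ u∈A₁ = q⊆p∪q E A₁ u∈A₁
  ... | in-A₂ u∈A₂ = p⊆p∪q A₁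
        (A₂-closed (λ w∈U₂ w∈D → ∪-left w∈D (λ w∈A₁ → A₁∉U₂ w∈A₁ w∈U₂)) E-closed u∈A₂ met)

  glue-closed : ∀ {E F μ} → E ⊆ U₂ → F ⊆ U₁ → v ∉ E → v ∉ F → deg G U₁ v F ≤ μ →
                Closed G U₂ (θ₂ μ) E → Closed G U₁ θ F → Closed G ⊤ θ (E ∪ F)
  glue-closed {E} {F} {μ} E⊆U₂ F⊆U₁ v∉E v∉F deg≤μ E-closed F-closed {u} _ met with position u
  ... | is-v refl  = p⊆p∪q F (E-closed v∈U₂
        (lowered-threshold-met μ (θ₂-at-v μ) met (NP.≤-trans (deg-split sides) (NP.+-monoʳ-≤ _ deg≤μ))))
    where
    sides : ∀ {w} → Counted G ⊤ v (E ∪ F) w → Counted G U₂ v E w ⊎ Counted G U₁ v F w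
    sides (a , _ , w∈E∪F) with x∈p∪q⁻ E F w∈E∪F
    ... | inj₁ w∈E = inj₁ (a , E⊆U₂ w∈E , w∈E)
    ... | inj₂ w∈F = inj₂ (a , F⊆U₁ w∈F , w∈F)
  ... | in-A₁ u∈A₁ = q⊆p∪q E F (A₁-closed
        (λ w∈U₁ w∈E∪F → ∪-right w∈E∪F λ w∈E → v∉E (subst (_∈ E) (U₁∩U₂ w∈U₁ (E⊆U₂ w∈E)) w∈E))
        F-closed u∈A₁ met)
  ... | in-A₂ u∈A₂ = p⊆p∪q F (A₂-closed
        (λ w∈U₂ w∈E∪F → ∪-left w∈E∪F λ w∈F → v∉F (subst (_∈ F) (U₁∩U₂ (F⊆U₁ w∈F) w∈U₂) w∈F))
        E-closed u∈A₂ met)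

  glue-targets : ∀ {S₁ S₂ μ} → IsTargetSet G A₁ θ₁ S₁ → μ ≤ m S₁ →
                 IsTargetSet G U₂ (θ₂ μ) S₂ → IsTargetSet G ⊤ θ (S₁ ∪ S₂)
  glue-targets {S₁} {S₂} {μ} S₁-target μ≤m S₂-target =
    target-intro G ⊤ θ ⊆⊤ λ {x} _ → all-active x
    where
    C = closure G ⊤ θ (S₁ ∪ S₂)

    C-closed : Closed G ⊤ θ C
    C-closed = closure-closed G ⊤ θ (S₁ ∪ S₂)

    S₁⊆C : S₁ ⊆ C
    S₁⊆C h = closure-ext G ⊤ θ _ (p⊆p∪q S₂ h)

    S₂⊆C : S₂ ⊆ C
    S₂⊆C h = closure-ext G ⊤ θ _ (q⊆p∪q S₁ S₂ h)

    -- C contains the activation of S₁ in (G₁, θ), so v has ≥ μ active neighbours in U₁.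
    μ≤deg : μ ≤ deg G U₁ v C
    μ≤deg = NP.≤-trans μ≤m (deg-monoʳ (closure-least G U₁ θ S₁⊆C (closed-restrict G ⊆⊤ C-closed)))

    U₂⊆C : U₂ ⊆ C
    U₂⊆C = target-fills G U₂ (θ₂ μ) S₂-target S₂⊆C (restrict-to-G₂ C-closed μ≤deg)

    A₁⊆C : A₁ ⊆ C
    A₁⊆C = target-fills G A₁ θ₁ S₁-target S₁⊆C (restrict-to-G₁-v C-closed (U₂⊆C v∈U₂))

    all-active : ∀ x → x ∈ C
    all-active x with position x
    ... | is-v refl  = U₂⊆C v∈U₂
    ... | in-A₁ x∈A₁ = A₁⊆C x∈A₁
    ... | in-A₂ x∈A₂ = U₂⊆C (A₂⊆U₂ x∈A₂)

  module Halves {T : Subset n} (T-target : IsTargetSet G ⊤ θ T) where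

    T₁ T₂ : Subset n
    T₁ = T ∩ A₁
    T₂ = T ∩ U₂

    ∣T₁∣+∣T₂∣≤∣T∣ : ∣ T₁ ∣ + ∣ T₂ ∣ ≤ ∣ T ∣
    ∣T₁∣+∣T₂∣≤∣T∣ = disjoint-parts (p∩q⊆p T A₁) (p∩q⊆p T U₂)
      λ h₁ h₂ → A₁∉U₂ (p∩q⊆q T A₁ h₁) (p∩q⊆q T U₂ h₂)

    fills-G : ∀ {D} → T ⊆ D → Closed G ⊤ θ D → ∀ x → x ∈ D
    fills-G T⊆D D-closed x = target-fills G ⊤ θ T-target T⊆D D-closed ∈⊤

    T₁-target : IsTargetSet G A₁ θ₁ T₁
    T₁-target = target-intro G A₁ θ₁ (p∩q⊆q T A₁) λ {x} x∈A₁ →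
      ∪-left (fills-G T⊆D∪U₂ (extend-from-G₁-v (closure-closed G A₁ θ₁ T₁)) x) (A₁∉U₂ x∈A₁)
      where
      D = closure G A₁ θ₁ T₁
      T⊆D∪U₂ : T ⊆ D ∪ U₂
      T⊆D∪U₂ {x} x∈T with position x
      ... | is-v refl  = q⊆p∪q D U₂ v∈U₂
      ... | in-A₁ x∈A₁ = p⊆p∪q U₂ (closure-ext G A₁ θ₁ T₁ (x∈p∩q⁺ (x∈T , x∈A₁)))
      ... | in-A₂ x∈A₂ = q⊆p∪q D U₂ (A₂⊆U₂ x∈A₂)

    T₂-extension-target : ∀ {X μ} → T₂ ⊆ X → X ⊆ U₂ → v ∈ closure G U₂ (θ₂ μ) X →
                          IsTargetSet G U₂ (θ₂ μ) X
    T₂-extension-target {X} {μ} T₂⊆X X⊆U₂ v∈E = target-intro G U₂ (θ₂ μ) X⊆U₂ λ {x} x∈U₂ →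
      ∪-left (fills-G T⊆E∪A₁ (extend-from-G₂ v∈E (closure-closed G U₂ (θ₂ μ) X)) x)
             (λ x∈A₁ → A₁∉U₂ x∈A₁ x∈U₂)
      where
      E = closure G U₂ (θ₂ μ) X
      T⊆E∪A₁ : T ⊆ E ∪ A₁
      T⊆E∪A₁ {x} x∈T with position x
      ... | is-v refl  = p⊆p∪q A₁ v∈E
      ... | in-A₁ x∈A₁ = q⊆p∪q E A₁ x∈A₁
      ... | in-A₂ x∈A₂ = p⊆p∪q A₁ (closure-ext G U₂ (θ₂ μ) X (T₂⊆X (x∈p∩q⁺ (x∈T , A₂⊆U₂ x∈A₂))))

    -- Either T₁ activates v in G₁, and then θ₂ μ v ≤ 0; or, were v
    -- inactive in both pieces, the two activations would glue to a closed set of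
    -- (G, θ) containing T but missing v.
    v-activated : ∀ {μ} → m T₁ ≤ μ → v ∈ closure G U₂ (θ₂ μ) T₂
    v-activated {μ} m≤μ = decide (v ∈? E) (v ∈? F)
      where
      E = closure G U₂ (θ₂ μ) T₂
      F = closure G U₁ θ T₁

      v-from-F : v ∈ F → v ∈ E
      v-from-F v∈F = closure-closed G U₂ (θ₂ μ) T₂ v∈U₂ (lowered-threshold-met μ (θ₂-at-v μ)
        (closure-supported G U₁ θ T₁ v∈F (λ v∈T₁ → v∉A₁ (p∩q⊆q T A₁ v∈T₁)))
        (NP.≤-trans m≤μ (NP.m≤n+m μ _)))

      T⊆E∪F : T ⊆ E ∪ F
      T⊆E∪F {x} x∈T with position x
      ... | is-v refl  = p⊆p∪q F (closure-ext G U₂ (θ₂ μ) T₂ (x∈p∩q⁺ (x∈T , v∈U₂)))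
      ... | in-A₁ x∈A₁ = q⊆p∪q E F (closure-ext G U₁ θ T₁ (x∈p∩q⁺ (x∈T , x∈A₁)))
      ... | in-A₂ x∈A₂ = p⊆p∪q F (closure-ext G U₂ (θ₂ μ) T₂ (x∈p∩q⁺ (x∈T , A₂⊆U₂ x∈A₂)))

      stuck : v ∉ E → v ∉ F → ⊥
      stuck v∉E v∉F = [ v∉E , v∉F ]′ (x∈p∪q⁻ E F (fills-G T⊆E∪F
        (glue-closed (closure-within G U₂ (θ₂ μ) (p∩q⊆q T U₂))
                     (closure-within G U₁ θ (λ h → A₁⊆U₁ (p∩q⊆q T A₁ h)))
                     v∉E v∉F m≤μ (closure-closed G U₂ (θ₂ μ) T₂) (closure-closed G U₁ θ T₁)) v))

      decide : Dec (v ∈ E) → Dec (v ∈ F) → v ∈ E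
      decide (yes v∈E) _         = v∈E
      decide (no  _)   (yes v∈F) = v-from-F v∈F
      decide (no  v∉E) (no  v∉F) = ⊥-elim (stuck v∉E v∉F)

    with-v-target : ∀ {μ} → IsTargetSet G U₂ (θ₂ μ) (⁅ v ⁆ ∪ T₂)
    with-v-target {μ} = T₂-extension-target (q⊆p∪q ⁅ v ⁆ T₂) ⁅v⁆∪T₂⊆U₂
      (closure-ext G U₂ (θ₂ μ) (⁅ v ⁆ ∪ T₂) (p⊆p∪q T₂ (x∈⁅x⁆ v)))
      where
      ⁅v⁆∪T₂⊆U₂ : ⁅ v ⁆ ∪ T₂ ⊆ U₂
      ⁅v⁆∪T₂⊆U₂ h = [ (λ h′ → subst (_∈ U₂) (sym (x∈⁅y⁆⇒x≡y v h′)) v∈U₂) , p∩q⊆q T U₂ ]′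
                      (x∈p∪q⁻ ⁅ v ⁆ T₂ h)

    lower-bound : ∀ {S₁ k₁ k₂} → (∀ T′ → IsOptimal G A₁ θ₁ T′ → m T′ ≤ m S₁) →
                  IsMinSeed G A₁ θ₁ k₁ → IsMinSeed G U₂ (θ₂ (m S₁)) k₂ → k₁ + k₂ ≤ ∣ T ∣
    lower-bound {k₁ = k₁} {k₂} maximal min₁ min₂ with NP.m≤n⇒m<n∨m≡n (proj₂ min₁ T₁ T₁-target)
    ... | inj₁ k₁<∣T₁∣ = begin
      k₁ + k₂          ≤⟨ NP.+-monoʳ-≤ k₁ k₂≤1+∣T₂∣ ⟩
      k₁ + suc ∣ T₂ ∣  ≡⟨ NP.+-suc k₁ ∣ T₂ ∣ ⟩
      suc k₁ + ∣ T₂ ∣  ≤⟨ NP.+-monoˡ-≤ ∣ T₂ ∣ k₁<∣T₁∣ ⟩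
      ∣ T₁ ∣ + ∣ T₂ ∣  ≤⟨ ∣T₁∣+∣T₂∣≤∣T∣ ⟩
      ∣ T ∣            ∎
      where
      open NP.≤-Reasoning
      k₂≤1+∣T₂∣ : k₂ ≤ suc ∣ T₂ ∣
      k₂≤1+∣T₂∣ = NP.≤-trans (proj₂ min₂ (⁅ v ⁆ ∪ T₂) with-v-target)
        (subst (∣ ⁅ v ⁆ ∪ T₂ ∣ ≤_) (cong (λ k → k + ∣ T₂ ∣) (∣⁅x⁆∣≡1 v)) (∣p∪q∣≤∣p∣+∣q∣ ⁅ v ⁆ T₂))
    ... | inj₂ k₁≡∣T₁∣ = begin
      k₁ + k₂          ≤⟨ NP.+-monoʳ-≤ k₁ k₂≤∣T₂∣ ⟩
      k₁ + ∣ T₂ ∣      ≡⟨ cong (λ k → k + ∣ T₂ ∣) k₁≡∣T₁∣ ⟩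
      ∣ T₁ ∣ + ∣ T₂ ∣  ≤⟨ ∣T₁∣+∣T₂∣≤∣T∣ ⟩
      ∣ T ∣            ∎
      where
      open NP.≤-Reasoning
      -- T₁ is optimal, so by maximality of S₁ the set T₂ alone activates v.
      T₁-optimal : IsOptimal G A₁ θ₁ T₁
      T₁-optimal = min-size-optimal G A₁ θ₁ min₁ T₁-target (sym k₁≡∣T₁∣)
      k₂≤∣T₂∣ : k₂ ≤ ∣ T₂ ∣
      k₂≤∣T₂∣ = proj₂ min₂ T₂
        (T₂-extension-target id (p∩q⊆q T U₂) (v-activated (maximal T₁ T₁-optimal)))

corollary3 : ∀ (n : ℕ) (G : Graph n) (θ : Fin n → ℤ) (v : Fin n) (A₁ A₂ : Subset n) →
    Connected G ⊤ →
    IsCutVertex G v →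
    IsVertexSumSplit G v A₁ A₂ →
    let U₁ = ⁅ v ⁆ ∪ A₁
        U₂ = ⁅ v ⁆ ∪ A₂
        θ₁ = theta1 G U₁ v θ
        m : Subset n → ℕ
        m S = ∣ nbrIn G U₁ v ∩ closure G U₁ θ S ∣
    in (S₁ : Subset n) →
    IsOptimal G (U₁ - v) θ₁ S₁ →
    (∀ T → IsOptimal G (U₁ - v) θ₁ T → m T ≤ m S₁) →
    ∀ (k₁ k₂ : ℕ) →
    IsMinSeed G (U₁ - v) θ₁ k₁ →
    IsMinSeed G U₂ (theta2 v θ (m S₁)) k₂ →
    IsMinSeed G ⊤ θ (k₁ + k₂)
corollary3 n G θ v A₁ A₂ _ _ split S₁ S₁-optimal maximal k₁ k₂ min₁
           min₂@((S₂ , S₂-target , ∣S₂∣≡k₂) , _) =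
  (S₁ ∪ S₂ , glue-targets (proj₁ S₁-optimal′) NP.≤-refl S₂-target , ∣S₁∪S₂∣≡k₁+k₂) ,
  λ T T-target → Halves.lower-bound T-target maximal′ min₁′ min₂
  where
  open VertexSum G θ v A₁ A₂ split
  open Relation.Binary.PropositionalEquality.≡-Reasoning

  S₁-optimal′ : IsOptimal G A₁ θ₁ S₁
  S₁-optimal′ = subst (λ A → IsOptimal G A θ₁ S₁) U₁-v≡A₁ S₁-optimal

  maximal′ : ∀ T → IsOptimal G A₁ θ₁ T → m T ≤ m S₁
  maximal′ T T-optimal = maximal T (subst (λ A → IsOptimal G A θ₁ T) (sym U₁-v≡A₁) T-optimal)

  min₁′ : IsMinSeed G A₁ θ₁ k₁
  min₁′ = subst (λ A → IsMinSeed G A θ₁ k₁) U₁-v≡A₁ min₁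

  -- The two seed sets live on the disjoint sets A₁ and U₂.
  ∣S₁∪S₂∣≡k₁+k₂ : ∣ S₁ ∪ S₂ ∣ ≡ k₁ + k₂
  ∣S₁∪S₂∣≡k₁+k₂ = begin
    ∣ S₁ ∪ S₂ ∣    ≡⟨ ∣p∪q∣≡∣p∣+∣q∣ (λ h₁ h₂ → A₁∉U₂ (proj₁ (proj₁ S₁-optimal′) h₁) (proj₁ S₂-target h₂)) ⟩
    ∣ S₁ ∣ + ∣ S₂ ∣ ≡⟨ cong₂ _+_ (optimal-size G A₁ θ₁ min₁′ S₁-optimal′) ∣S₂∣≡k₂ ⟩
    k₁ + k₂        ∎
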